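{- Let $L$ be a countable linear ordering and let $\Phi(L)$ be the colored linear ordering whose underlying ordering is $Bk(L)$ and in which each block is colored by its order type (one of the colors $n$ for finite $n\ge1$, $\omega$, $\omega^*$, $\zeta$). Then $(L,<,s,p)$ is homogeneous if and only if $\Phi(L)$ is homogeneous (as a structure with $<$ and one unary predicate for each color).
   Context: $s(x)$ is the immediate successor of $x$ in $L$ if it exists and $s(x)=x$ otherwise; $p(x)$ likewise for predecessors. Blocks are the classes of the equivalence relation "finitely many elements lie between them"; $Bk(L)$ is the induced ordering of blocks. A structure is homogeneous if every isomorphism between finitely generated substructures extends to an automorphism. -}

module Defs where

open import Level using (0ℓ) renaming (suc to lsuc)
open import Data.Nat using (ℕ; _>_)
import Data.Nat as ℕ
open import Data.Integer using (ℤ)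
import Data.Integer as ℤ
open import Data.Fin using (Fin)
import Data.Fin as F
open import Data.List using (List; _∷_; [])
open import Data.List.Membership.Propositional using (_∈_)
open import Data.Product using (Σ; ∃; _×_; _,_)
open import Data.Sum using (_⊎_)
open import Relation.Nullary using (¬_)
open import Relation.Binary.PropositionalEquality using (_≡_)
open import Relation.Binary using (Transitive; Trichotomous)
open import Function using (Injective; _⇔_)

record LinearOrder : Set₁ where
  field
    Carrier : Set
    _<_     : Carrier → Carrier → Set
    trans   : Transitive _<_
    compare : Trichotomous _≡_ _<_

record CountableLinearOrder : Set₁ where
  field
    order     : LinearOrder
  open LinearOrder order public
  field
    code      : Carrier → ℕ
    code-inj  : Injective _≡_ _≡_ code

module _ (L : CountableLinearOrder) where
  open CountableLinearOrder L

  -- Immediate successor (as a relation).  s(x) = y iff Succ x y, or x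
  -- has no immediate successor and y = x.  p(x) = y iff Succ y x, or x
  -- has no immediate predecessor and y = x.
  Succ : Carrier → Carrier → Set
  Succ x y = (x < y) × (∀ z → ¬ ((x < z) × (z < y)))

  Between : Carrier → Carrier → Carrier → Set
  Between x y z = ((x < z) × (z < y)) ⊎ ((y < z) × (z < x))

  SameBlock : Carrier → Carrier → Set
  SameBlock x y = Σ (List Carrier) λ zs → ∀ z → Between x y z → z ∈ zs

  BkLt : Carrier → Carrier → Set
  BkLt x y = (x < y) × ¬ SameBlock x y

  data Color : Set where
    finite : ℕ → Color
    omega omegaStar zeta : Color

  ModelCarrier : Color → Set
  ModelCarrier (finite n) = Fin n
  ModelCarrier omega      = ℕ
  ModelCarrier omegaStar  = ℕ
  ModelCarrier zeta       = ℤ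

  ModelLt : (c : Color) → ModelCarrier c → ModelCarrier c → Set
  ModelLt (finite n) = F._<_
  ModelLt omega      = ℕ._<_
  ModelLt omegaStar  = _>_
  ModelLt zeta       = ℤ._<_

  HasType : Carrier → Color → Set
  HasType x c =
    Σ (ModelCarrier c → Carrier) λ f →
        (∀ t → SameBlock x (f t))
      × (∀ y → SameBlock x y → ∃ λ t → f t ≡ y)
      × (∀ t u → ModelLt c t u ⇔ (f t < f u))

  data Gen (xs : List Carrier) : Carrier → Set where
    base : ∀ {x} → x ∈ xs → Gen xs x
    sucC : ∀ {x y} → Gen xs x → Succ x y → Gen xs y
    preC : ∀ {x y} → Gen xs x → Succ y x → Gen xs y

  record PartialIso (xs ys : List Carrier)
                    (R : Carrier → Carrier → Set) : Set where
    field
      total  : ∀ x → Gen xs x → ∃ λ y → R x y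
      dom⊆   : ∀ {x y} → R x y → Gen xs x
      onto   : ∀ y → Gen ys y → ∃ λ x → R x y
      ran⊆   : ∀ {x y} → R x y → Gen ys y
      func   : ∀ {x y y′} → R x y → R x y′ → y ≡ y′
      inj    : ∀ {x x′ y} → R x y → R x′ y → x ≡ x′
      ord    : ∀ {x y x′ y′} → R x y → R x′ y′ → (x < x′) ⇔ (y < y′)
      succ   : ∀ {x y x′ y′} → R x y → R x′ y′ → Succ x x′ ⇔ Succ y y′

  record Automorphism (g : Carrier → Carrier) : Set where
    field
      inv      : Carrier → Carrier
      inv-l    : ∀ x → inv (g x) ≡ x
      inv-r    : ∀ y → g (inv y) ≡ y
      ord      : ∀ x y → (x < y) ⇔ (g x < g y)
      succ     : ∀ x y → Succ x y ⇔ Succ (g x) (g y)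

  HomogeneousL : Set₁
  HomogeneousL =
    ∀ (xs ys : List Carrier) (R : Carrier → Carrier → Set) →
      PartialIso xs ys R →
      Σ (Carrier → Carrier) λ g →
        Automorphism g × (∀ {x y} → R x y → g x ≡ y)

  -- Homogeneity of Φ(L) = (Bk(L), <, colors).  Blocks are represented
  -- by their elements, with SameBlock as the equality (setoid).

  record BlockAutomorphism (g : Carrier → Carrier) : Set where
    field
      resp     : ∀ x y → SameBlock x y → SameBlock (g x) (g y)
      onto     : ∀ y → ∃ λ x → SameBlock (g x) y
      ord      : ∀ x y → BkLt x y ⇔ BkLt (g x) (g y)
      color    : ∀ x c → HasType x c ⇔ HasType (g x) c

  HomogeneousΦ : Set
  HomogeneousΦ =
    ∀ (n : ℕ) (xs ys : Fin n → Carrier) →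
      (∀ i j → SameBlock (xs i) (xs j) ⇔ SameBlock (ys i) (ys j)) →
      (∀ i j → BkLt (xs i) (xs j) ⇔ BkLt (ys i) (ys j)) →
      (∀ i c → HasType (xs i) c ⇔ HasType (ys i) c) →
      Σ (Carrier → Carrier) λ g →
        BlockAutomorphism g × (∀ i → SameBlock (g (xs i)) (ys i))

-- Every block of L is a finite, ω, ω* or ζ chain of immediate successors, and the
-- (<,s,p)-substructure generated by finitely many points is the union of their blocks.
-- Hence a partial isomorphism of (L,<,s,p) amounts to a partial isomorphism of Φ(L)
-- (an order isomorphism between finitely many blocks preserving their types) together
-- with order isomorphisms between the paired blocks. Extensions are built blockwise in
-- both directions: a block not yet covered is sent by an isomorphism onto a block of
-- the same type, chosen once per pair of blocks through the element of least code in
-- each block, so that the choice does not depend on the point used to name a block.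
module Submission where

open import Defs
import Level
open import Level using (0ℓ)
open import Axiom.ExcludedMiddle using (ExcludedMiddle)
open import Axiom.DoubleNegationElimination using (em⇒dne)
open import Data.Nat as ℕ using (ℕ; zero; suc; _+_; s≤s)
import Data.Nat.Properties as ℕ
open import Data.Integer as ℤ using (ℤ; +_; -[1+_])
import Data.Integer.Properties as ℤ
open import Data.Fin as Fin using (Fin)
import Data.Fin.Properties as Fin
import Relation.Binary.Construct.Flip.EqAndOrd as Flip
open import Data.List using (List; []; _∷_; _++_; map; tabulate; length; lookup)
open import Data.List.Membership.Propositional using (_∈_)
open import Data.List.Membership.Propositional.Properties using (∈-++⁺ˡ; ∈-++⁺ʳ; ∈-map⁺; ∈-tabulate⁺; ∈-tabulate⁻; ∈-lookup)
open import Data.List.Relation.Unary.Any as Any using (here; there)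
open import Data.List.Relation.Unary.Any.Properties using (¬Any[]; lookup-index)
open import Data.Product using (Σ; ∃; ∃₂; _×_; _,_; proj₁; proj₂)
open import Data.Sum using (inj₁; inj₂)
open import Data.Empty using (⊥-elim)
open import Function using (_⇔_; mk⇔; Equivalence; _∘_; flip)
import Function.Properties.Equivalence as ⇔
open import Function.Related.Propositional using (module EquationalReasoning)
open import Relation.Nullary using (¬_; Dec; yes; no)
open import Relation.Binary using (Trichotomous; tri<; tri≈; tri>)
open import Relation.Binary.PropositionalEquality using (_≡_; refl; sym; cong; cong₂; subst; subst₂) renaming (trans to trans≡)

open Equivalence using (to; from)

module Blocks (L : CountableLinearOrder) where
  open CountableLinearOrder L

  <-irrefl : ∀ {x} → ¬ x < x
  <-irrefl {x} x<x with compare x x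
  ... | tri< _ x≢x _ = x≢x refl
  ... | tri≈ x≮x _ _ = x≮x x<x
  ... | tri> _ x≢x _ = x≢x refl

  <-asym : ∀ {x y} → x < y → ¬ y < x
  <-asym x<y y<x = <-irrefl (trans x<y y<x)

  strictMono⇒reflects : ∀ {A : Set} {_⊏_ : A → A → Set} → Trichotomous _≡_ _⊏_ →
                        (f : A → Carrier) → (∀ {a b} → a ⊏ b → f a < f b) →
                        ∀ a b → a ⊏ b ⇔ f a < f b
  strictMono⇒reflects {_⊏_ = _⊏_} cmp f mono a b = mk⇔ mono reflect
    where
    reflect : f a < f b → a ⊏ b
    reflect fa<fb with cmp a b
    ... | tri< a⊏b _ _ = a⊏b
    ... | tri≈ _ refl _ = ⊥-elim (<-irrefl fa<fb)
    ... | tri> _ _ b⊏a = ⊥-elim (<-asym fa<fb (mono b⊏a))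

  same-order⇒same-kernel : ∀ {A : Set} {_⊏_ : A → A → Set} {f g : A → Carrier} →
                        (∀ t u → t ⊏ u ⇔ f t < f u) → (∀ t u → t ⊏ u ⇔ g t < g u) →
                        ∀ {t u} → f t ≡ f u → g t ≡ g u
  same-order⇒same-kernel {f = f} {g} f-ord g-ord {t} {u} ft≡fu with compare (g t) (g u)
  ... | tri≈ _ gt≡gu _ = gt≡gu
  ... | tri< gt<gu _ _ =
    ⊥-elim (<-irrefl (subst (f t <_) (sym ft≡fu) (to (f-ord t u) (from (g-ord t u) gt<gu))))
  ... | tri> _ _ gu<gt =
    ⊥-elim (<-irrefl (subst (f u <_) ft≡fu (to (f-ord u t) (from (g-ord u t) gu<gt))))

  infix 4 _~_ _⋖_
  _~_ : Carrier → Carrier → Set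
  _~_ = SameBlock L

  _⋖_ : Carrier → Carrier → Set
  _⋖_ = Succ L

  ~-refl : ∀ {x} → x ~ x
  ~-refl = [] , λ { _ (inj₁ (x<z , z<x)) → ⊥-elim (<-asym x<z z<x)
                  ; _ (inj₂ (x<z , z<x)) → ⊥-elim (<-asym x<z z<x) }

  ~-reflexive : ∀ {x y} → x ≡ y → x ~ y
  ~-reflexive refl = ~-refl

  ~-sym : ∀ {x y} → x ~ y → y ~ x
  ~-sym (zs , between⊆zs) = zs , λ { z (inj₁ b) → between⊆zs z (inj₂ b)
                                   ; z (inj₂ b) → between⊆zs z (inj₁ b) }

  ~-trans : ∀ {x y z} → x ~ y → y ~ z → x ~ z
  ~-trans {x} {y} {z} (zs₁ , h₁) (zs₂ , h₂) = zs₁ ++ y ∷ zs₂ , covered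
    where
    covered : ∀ w → Between L x z w → w ∈ zs₁ ++ y ∷ zs₂
    covered w b with compare w y
    covered w _                  | tri≈ _ refl _ = ∈-++⁺ʳ zs₁ (here refl)
    covered w (inj₁ (x<w , _))   | tri< w<y _ _  = ∈-++⁺ˡ (h₁ w (inj₁ (x<w , w<y)))
    covered w (inj₁ (_ , w<z))   | tri> _ _ y<w  = ∈-++⁺ʳ zs₁ (there (h₂ w (inj₁ (y<w , w<z))))
    covered w (inj₂ (z<w , _))   | tri< w<y _ _  = ∈-++⁺ʳ zs₁ (there (h₂ w (inj₂ (z<w , w<y))))
    covered w (inj₂ (_ , w<x))   | tri> _ _ y<w  = ∈-++⁺ˡ (h₁ w (inj₂ (y<w , w<x)))

  ~-convex : ∀ {u v w} → u ~ w → u < v → v < w → u ~ v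
  ~-convex (zs , h) u<v v<w =
    zs , λ { z (inj₁ (u<z , z<v)) → h z (inj₁ (u<z , trans z<v v<w))
           ; z (inj₂ (v<z , z<u)) → ⊥-elim (<-asym u<v (trans v<z z<u)) }

  ⋖⇒~ : ∀ {x y} → x ⋖ y → x ~ y
  ⋖⇒~ (x<y , nothing-between) =
    [] , λ { z (inj₁ x<z<y) → ⊥-elim (nothing-between z x<z<y)
           ; z (inj₂ (y<z , z<x)) → ⊥-elim (<-asym x<y (trans y<z z<x)) }

  ⋖-functionalʳ : ∀ {x y y′} → x ⋖ y → x ⋖ y′ → y ≡ y′
  ⋖-functionalʳ {y = y} {y′} (x<y , ¬x<·<y) (x<y′ , ¬x<·<y′) with compare y y′
  ... | tri< y<y′ _ _ = ⊥-elim (¬x<·<y′ y (x<y , y<y′))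
  ... | tri≈ _ y≡y′ _ = y≡y′
  ... | tri> _ _ y′<y = ⊥-elim (¬x<·<y y′ (x<y′ , y′<y))

  ⋖-functionalˡ : ∀ {x y y′} → y ⋖ x → y′ ⋖ x → y ≡ y′
  ⋖-functionalˡ {y = y} {y′} (y<x , ¬y<·<x) (y′<x , ¬y′<·<x) with compare y y′
  ... | tri< y<y′ _ _ = ⊥-elim (¬y<·<x y′ (y<y′ , y′<x))
  ... | tri≈ _ y≡y′ _ = y≡y′
  ... | tri> _ _ y′<y = ⊥-elim (¬y′<·<x y (y′<y , y<x))

  data Steps : ℕ → Carrier → Carrier → Set where
    [] : ∀ {x} → Steps 0 x x
    _∷_ : ∀ {k x y z} → x ⋖ y → Steps k y z → Steps (suc k) x z

  steps⇒~ : ∀ {k x y} → Steps k x y → x ~ y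
  steps⇒~ [] = ~-refl
  steps⇒~ (x⋖y ∷ r) = ~-trans (⋖⇒~ x⋖y) (steps⇒~ r)

  steps-suc⇒< : ∀ {k x y} → Steps (suc k) x y → x < y
  steps-suc⇒< (x⋖y ∷ []) = proj₁ x⋖y
  steps-suc⇒< (x⋖y ∷ r@(_ ∷ _)) = trans (proj₁ x⋖y) (steps-suc⇒< r)

  steps-++ : ∀ {m n x y z} → Steps m x y → Steps n y z → Steps (m + n) x z
  steps-++ [] r = r
  steps-++ (q ∷ l) r = q ∷ steps-++ l r

  steps-split : ∀ m {n x z} → Steps (m + n) x z → ∃ λ y → Steps m x y × Steps n y z
  steps-split zero r = _ , [] , r
  steps-split (suc m) (q ∷ r) with steps-split m r
  ... | y , l , r′ = y , q ∷ l , r′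

  steps-∷ʳ : ∀ {k x y z} → Steps k x y → y ⋖ z → Steps (suc k) x z
  steps-∷ʳ [] q = q ∷ []
  steps-∷ʳ (q′ ∷ r) q = q′ ∷ steps-∷ʳ r q

  steps-unsnoc : ∀ {k x z} → Steps (suc k) x z → ∃ λ y → Steps k x y × y ⋖ z
  steps-unsnoc (q ∷ []) = _ , [] , q
  steps-unsnoc (q ∷ r@(_ ∷ _)) with steps-unsnoc r
  ... | y , l , q′ = y , q ∷ l , q′

  steps-functionalʳ : ∀ {k x y y′} → Steps k x y → Steps k x y′ → y ≡ y′
  steps-functionalʳ [] [] = refl
  steps-functionalʳ (q ∷ r) (q′ ∷ r′) with ⋖-functionalʳ q q′
  ... | refl = steps-functionalʳ r r′

  steps-functionalˡ : ∀ {k x y y′} → Steps k y x → Steps k y′ x → y ≡ y′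
  steps-functionalˡ {zero} [] [] = refl
  steps-functionalˡ {suc k} r r′ with steps-unsnoc r | steps-unsnoc r′
  ... | _ , l , q | _ , l′ , q′ with ⋖-functionalˡ q q′
  ... | refl = steps-functionalˡ l l′

  steps-monoʳ : ∀ {k m x u v} → Steps k x u → Steps m x v → k ℕ.< m → u < v
  steps-monoʳ [] r′ (s≤s _) = steps-suc⇒< r′
  steps-monoʳ (q ∷ r) (q′ ∷ r′) (s≤s k<m) with ⋖-functionalʳ q q′
  ... | refl = steps-monoʳ r r′ k<m

  steps-monoˡ : ∀ {k m x u v} → Steps k u x → Steps m v x → k ℕ.< m → v < u
  steps-monoˡ {zero} [] r′ (s≤s _) = steps-suc⇒< r′
  steps-monoˡ {suc k} {suc m} r r′ (s≤s k<m) with steps-unsnoc r | steps-unsnoc r′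
  ... | _ , l , q | _ , l′ , q′ with ⋖-functionalˡ q q′
  ... | refl = steps-monoˡ l l′ k<m

  between? : ∀ x a y → Dec (x < a × a < y)
  between? x a y with compare x a | compare a y
  ... | tri< x<a _ _ | tri< a<y _ _ = yes (x<a , a<y)
  ... | tri< _ _ _   | tri≈ a≮y _ _ = no (a≮y ∘ proj₂)
  ... | tri< _ _ _   | tri> a≮y _ _ = no (a≮y ∘ proj₂)
  ... | tri≈ x≮a _ _ | _ = no (x≮a ∘ proj₁)
  ... | tri> x≮a _ _ | _ = no (x≮a ∘ proj₁)

  finite-interval⇒steps : (zs : List Carrier) → ∀ {x y} → x < y →
                          (∀ z → x < z → z < y → z ∈ zs) → ∃ λ k → Steps (suc k) x y
  finite-interval⇒steps [] x<y ⊆[] =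
    0 , (x<y , λ z (x<z , z<y) → ¬Any[] (⊆[] z x<z z<y)) ∷ []
  finite-interval⇒steps (a ∷ zs) {x} {y} x<y ⊆a∷zs with between? x a y
  ... | yes (x<a , a<y) =
    let k , l = finite-interval⇒steps zs x<a λ z x<z z<a →
                  Any.tail (λ z≡a → <-irrefl (subst (_< a) z≡a z<a)) (⊆a∷zs z x<z (trans z<a a<y))
        m , r = finite-interval⇒steps zs a<y λ z a<z z<y →
                  Any.tail (λ z≡a → <-irrefl (subst (a <_) z≡a a<z)) (⊆a∷zs z (trans x<a a<z) z<y)
    in k + suc m , steps-++ l r
  ... | no a∉ = finite-interval⇒steps zs x<y λ z x<z z<y →
                  Any.tail (λ { refl → a∉ (x<z , z<y) }) (⊆a∷zs z x<z z<y)

  ~⇒steps : ∀ {x y} → x < y → x ~ y → ∃ λ k → Steps (suc k) x y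
  ~⇒steps x<y (zs , h) = finite-interval⇒steps zs x<y λ z x<z z<y → h z (inj₁ (x<z , z<y))

  HasSucc HasPred : Carrier → Set
  HasSucc x = ∃ λ y → x ⋖ y
  HasPred x = ∃ λ y → y ⋖ x

  ¬HasSucc⇒blockMax : ∀ {e y} → ¬ HasSucc e → e < y → ¬ e ~ y
  ¬HasSucc⇒blockMax ¬succ e<y e~y with ~⇒steps e<y e~y
  ... | _ , q ∷ _ = ¬succ (_ , q)

  ¬HasPred⇒blockMin : ∀ {b y} → ¬ HasPred b → y < b → ¬ y ~ b
  ¬HasPred⇒blockMin ¬pred y<b y~b with steps-unsnoc (proj₂ (~⇒steps y<b y~b))
  ... | _ , _ , q = ¬pred (_ , q)

  BkLt-resp-~ : ∀ {a a′ b b′} → a ~ a′ → b ~ b′ → BkLt L a b → BkLt L a′ b′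
  BkLt-resp-~ {a} {a′} {b} {b′} a~a′ b~b′ (a<b , a≁b) = a′<b′ , a′≁b′
    where
    a′≁b′ : ¬ a′ ~ b′
    a′≁b′ a′~b′ = a≁b (~-trans a~a′ (~-trans a′~b′ (~-sym b~b′)))
    a′<b′ : a′ < b′
    a′<b′ with compare a′ b′
    ... | tri< a′<b′ _ _ = a′<b′
    ... | tri≈ _ refl _ = ⊥-elim (a′≁b′ ~-refl)
    ... | tri> _ _ b′<a′ with compare b a′
    ...   | tri< b<a′ _ _ = ⊥-elim (a≁b (~-convex a~a′ a<b b<a′))
    ...   | tri≈ _ refl _ = ⊥-elim (a≁b a~a′)
    ...   | tri> _ _ a′<b = ⊥-elim (a≁b (~-trans a~a′
                              (~-trans (~-sym (~-convex (~-sym b~b′) b′<a′ a′<b)) (~-sym b~b′))))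

  BkLt-cong : ∀ {a a′ b b′} → a ~ a′ → b ~ b′ → BkLt L a b ⇔ BkLt L a′ b′
  BkLt-cong a~a′ b~b′ = mk⇔ (BkLt-resp-~ a~a′ b~b′) (BkLt-resp-~ (~-sym a~a′) (~-sym b~b′))

  ≁⇒<⇔BkLt : ∀ {x y} → ¬ x ~ y → x < y ⇔ BkLt L x y
  ≁⇒<⇔BkLt x≁y = mk⇔ (_, x≁y) proj₁

  gen-steps : ∀ {xs k x y} → Gen L xs x → Steps k x y → Gen L xs y
  gen-steps g [] = g
  gen-steps g (q ∷ r) = gen-steps (sucC g q) r

  gen-stepsˡ : ∀ {xs k x y} → Gen L xs x → Steps k y x → Gen L xs y
  gen-stepsˡ {k = zero} g [] = g
  gen-stepsˡ {k = suc k} g r with steps-unsnoc r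
  ... | _ , l , q = gen-stepsˡ (preC g q) l

  gen-resp-~ : ∀ {xs x y} → Gen L xs x → x ~ y → Gen L xs y
  gen-resp-~ {x = x} {y} g x~y with compare x y
  ... | tri< x<y _ _ = gen-steps g (proj₂ (~⇒steps x<y x~y))
  ... | tri≈ _ refl _ = g
  ... | tri> _ _ y<x = gen-stepsˡ g (proj₂ (~⇒steps y<x (~-sym x~y)))

  gen⇒~generator : ∀ {xs x} → Gen L xs x → ∃ λ z → z ∈ xs × z ~ x
  gen⇒~generator (base z∈xs) = _ , z∈xs , ~-refl
  gen⇒~generator (sucC g q) with gen⇒~generator g
  ... | z , z∈xs , z~x = z , z∈xs , ~-trans z~x (⋖⇒~ q)
  gen⇒~generator (preC g q) with gen⇒~generator g
  ... | z , z∈xs , z~x = z , z∈xs , ~-trans z~x (~-sym (⋖⇒~ q))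

  record BlockIso (a b : Carrier) (h : Carrier → Carrier) : Set where
    field
      maps : ∀ z → a ~ z → b ~ h z
      onto : ∀ w → b ~ w → ∃ λ z → a ~ z × h z ≡ w
      ord  : ∀ z z′ → a ~ z → a ~ z′ → z < z′ ⇔ h z < h z′

  blockIso-id : ∀ {a b} → a ~ b → BlockIso a b (λ z → z)
  blockIso-id a~b = record
    { maps = λ z a~z → ~-trans (~-sym a~b) a~z
    ; onto = λ w b~w → w , ~-trans a~b b~w , refl
    ; ord  = λ _ _ _ _ → ⇔.refl
    }

  blockIso-resp-~ : ∀ {a a′ b b′ h} → a ~ a′ → b ~ b′ → BlockIso a b h → BlockIso a′ b′ h
  blockIso-resp-~ a~a′ b~b′ iso = record
    { maps = λ z a′~z → ~-trans (~-sym b~b′) (maps z (~-trans a~a′ a′~z))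
    ; onto = λ w b′~w → let z , a~z , hz≡w = onto w (~-trans b~b′ b′~w)
                        in z , ~-trans (~-sym a~a′) a~z , hz≡w
    ; ord  = λ z z′ a′~z a′~z′ → ord z z′ (~-trans a~a′ a′~z) (~-trans a~a′ a′~z′)
    }
    where open BlockIso iso

  module _ {a b h} (iso : BlockIso a b h) where
    open BlockIso iso

    blockIso-injective : ∀ {z z′} → a ~ z → a ~ z′ → h z ≡ h z′ → z ≡ z′
    blockIso-injective {z} {z′} a~z a~z′ hz≡hz′ with compare z z′
    ... | tri< z<z′ _ _ =
      ⊥-elim (<-irrefl (subst (h z <_) (sym hz≡hz′) (to (ord z z′ a~z a~z′) z<z′)))
    ... | tri≈ _ z≡z′ _ = z≡z′
    ... | tri> _ _ z′<z =
      ⊥-elim (<-irrefl (subst (h z′ <_) hz≡hz′ (to (ord z′ z a~z′ a~z) z′<z)))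

    blockIso-⋖ : ∀ {z z′} → a ~ z → a ~ z′ → z ⋖ z′ ⇔ h z ⋖ h z′
    blockIso-⋖ {z} {z′} a~z a~z′ = mk⇔ preserve reflect
      where
      preserve : z ⋖ z′ → h z ⋖ h z′
      preserve (z<z′ , ¬z<·<z′) = to (ord z z′ a~z a~z′) z<z′ , λ w (hz<w , w<hz′) →
        let hz~w = ~-convex (~-trans (~-sym (maps z a~z)) (maps z′ a~z′)) hz<w w<hz′
            u , a~u , hu≡w = onto w (~-trans (maps z a~z) hz~w)
        in ¬z<·<z′ u ( from (ord z u a~z a~u) (subst (h z <_) (sym hu≡w) hz<w)
                     , from (ord u z′ a~u a~z′) (subst (_< h z′) (sym hu≡w) w<hz′))
      reflect : h z ⋖ h z′ → z ⋖ z′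
      reflect (hz<hz′ , ¬hz<·<hz′) = from (ord z z′ a~z a~z′) hz<hz′ , λ u (z<u , u<z′) →
        let a~u = ~-trans a~z (~-convex (~-trans (~-sym a~z) a~z′) z<u u<z′)
        in ¬hz<·<hz′ (h u) (to (ord z u a~z a~u) z<u , to (ord u z′ a~u a~z′) u<z′)

    hasType-transport : ∀ {c} → HasType L a c → HasType L b c
    hasType-transport {c} (f , a~f , f-onto , f-ord) = h ∘ f , b~hf , hf-onto , hf-ord
      where
      b~hf : ∀ t → b ~ h (f t)
      b~hf t = maps (f t) (a~f t)
      hf-onto : ∀ w → b ~ w → ∃ λ t → h (f t) ≡ w
      hf-onto w b~w with onto w b~w
      ... | z , a~z , hz≡w with f-onto z a~z
      ... | t , refl = t , hz≡w
      hf-ord : ∀ t u → ModelLt L c t u ⇔ h (f t) < h (f u)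
      hf-ord t u = ⇔.trans (f-ord t u) (ord (f t) (f u) (a~f t) (a~f u))

  hasType-resp-~ : ∀ {a b c} → a ~ b → HasType L a c → HasType L b c
  hasType-resp-~ a~b = hasType-transport (blockIso-id a~b)

  OrderIso : (Carrier → Carrier) → Set
  OrderIso G = (∀ x y → x < y ⇔ G x < G y) × (∀ y → ∃ λ x → G x ≡ y)

  automorphism⇒orderIso : ∀ {G} → Automorphism L G → OrderIso G
  automorphism⇒orderIso aut = ord , λ y → inv y , inv-r y
    where open Automorphism aut

  module OrderIsoBasics {G : Carrier → Carrier} (iso : OrderIso G) where
    G-ord : ∀ x y → x < y ⇔ G x < G y
    G-ord = proj₁ iso

    G⁻¹ : Carrier → Carrier
    G⁻¹ y = proj₁ (proj₂ iso y)

    G∘G⁻¹ : ∀ y → G (G⁻¹ y) ≡ y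
    G∘G⁻¹ y = proj₂ (proj₂ iso y)

    G⁻¹∘G : ∀ x → G⁻¹ (G x) ≡ x
    G⁻¹∘G x = same-order⇒same-kernel G-ord (λ _ _ → ⇔.refl) (G∘G⁻¹ (G x))

    G⁻¹-mono : ∀ {u v} → u < v → G⁻¹ u < G⁻¹ v
    G⁻¹-mono {u} {v} u<v = from (G-ord (G⁻¹ u) (G⁻¹ v)) (subst₂ _<_ (sym (G∘G⁻¹ u)) (sym (G∘G⁻¹ v)) u<v)

    G⁻¹-orderIso : OrderIso G⁻¹
    G⁻¹-orderIso = strictMono⇒reflects compare G⁻¹ G⁻¹-mono , λ x → G x , G⁻¹∘G x

    G-~ : ∀ {x y} → x ~ y → G x ~ G y
    G-~ {x} {y} (zs , between⊆zs) = map G zs , λ w b →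
      subst (_∈ map G zs) (G∘G⁻¹ w) (∈-map⁺ G (between⊆zs (G⁻¹ w) (pull b)))
      where
      pull : ∀ {w} → Between L (G x) (G y) w → Between L x y (G⁻¹ w)
      pull (inj₁ (Gx<w , w<Gy)) =
        inj₁ (subst (_< _) (G⁻¹∘G x) (G⁻¹-mono Gx<w) , subst (_ <_) (G⁻¹∘G y) (G⁻¹-mono w<Gy))
      pull (inj₂ (Gy<w , w<Gx)) =
        inj₂ (subst (_< _) (G⁻¹∘G y) (G⁻¹-mono Gy<w) , subst (_ <_) (G⁻¹∘G x) (G⁻¹-mono w<Gx))

  module OrderIsoProperties {G : Carrier → Carrier} (iso : OrderIso G) where
    open OrderIsoBasics iso public
    private module Inverse = OrderIsoBasics G⁻¹-orderIso

    G-~⁻ : ∀ {x y} → G x ~ G y → x ~ y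
    G-~⁻ {x} {y} Gx~Gy = subst₂ _~_ (G⁻¹∘G x) (G⁻¹∘G y) (Inverse.G-~ Gx~Gy)

    G-blockIso : ∀ x → BlockIso x (G x) G
    G-blockIso x = record
      { maps = λ _ → G-~
      ; onto = λ w Gx~w → G⁻¹ w , G-~⁻ (subst (G x ~_) (sym (G∘G⁻¹ w)) Gx~w) , G∘G⁻¹ w
      ; ord  = λ z z′ _ _ → G-ord z z′
      }

    G⁻¹-blockIso : ∀ x → BlockIso (G x) x G⁻¹
    G⁻¹-blockIso x = record
      { maps = λ z Gx~z → G-~⁻ (subst (G x ~_) (sym (G∘G⁻¹ z)) Gx~z)
      ; onto = λ w x~w → G w , G-~ x~w , G⁻¹∘G w
      ; ord  = λ z z′ _ _ → proj₁ G⁻¹-orderIso z z′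
      }

    G-⋖ : ∀ x y → x ⋖ y ⇔ G x ⋖ G y
    G-⋖ x y = mk⇔ (λ x⋖y → to (within-block (⋖⇒~ x⋖y)) x⋖y)
                  (λ Gx⋖Gy → from (within-block (G-~⁻ (⋖⇒~ Gx⋖Gy))) Gx⋖Gy)
      where
      within-block : x ~ y → x ⋖ y ⇔ G x ⋖ G y
      within-block = blockIso-⋖ (G-blockIso x) ~-refl

    G-BkLt : ∀ x y → BkLt L x y ⇔ BkLt L (G x) (G y)
    G-BkLt x y = mk⇔ (λ (x<y , x≁y) → to (G-ord x y) x<y , x≁y ∘ G-~⁻)
                     (λ (Gx<Gy , Gx≁Gy) → from (G-ord x y) Gx<Gy , Gx≁Gy ∘ G-~)

    G-automorphism : Automorphism L G
    G-automorphism = record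
      { inv = G⁻¹ ; inv-l = G⁻¹∘G ; inv-r = G∘G⁻¹ ; ord = G-ord ; succ = G-⋖ }

    G-blockAutomorphism : BlockAutomorphism L G
    G-blockAutomorphism = record
      { resp  = λ _ _ → G-~
      ; onto  = λ y → G⁻¹ y , ~-reflexive (G∘G⁻¹ y)
      ; ord   = G-BkLt
      ; color = λ x c → mk⇔ (hasType-transport (G-blockIso x))
                           (hasType-transport (G⁻¹-blockIso x))
      }

  partialIso-flip : ∀ {xs ys R} → PartialIso L xs ys R → PartialIso L ys xs (λ y x → R x y)
  partialIso-flip π = record
    { total = onto ; dom⊆ = ran⊆ ; onto = total ; ran⊆ = dom⊆ ; func = inj ; inj = func
    ; ord = λ r r′ → ⇔.sym (ord r r′) ; succ = λ r r′ → ⇔.sym (succ r r′) }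
    where open PartialIso π

  module _ {xs ys R} (π : PartialIso L xs ys R) where
    open PartialIso π

    partialIso-steps : ∀ {k x y x′} → R x y → Steps k x x′ → ∃ λ y′ → R x′ y′ × Steps k y y′
    partialIso-steps r [] = _ , r , []
    partialIso-steps r (q ∷ rest) =
      let _ , r₁ = total _ (sucC (dom⊆ r) q)
          y′ , r′ , rest′ = partialIso-steps r₁ rest
      in y′ , r′ , to (succ r r₁) q ∷ rest′

    partialIso-~⁺ : ∀ {x y x′ y′} → R x y → R x′ y′ → x ~ x′ → y ~ y′
    partialIso-~⁺ {x} {y} {x′} {y′} r r′ x~x′ with compare x x′
    ... | tri< x<x′ _ _ = let _ , r″ , path = partialIso-steps r (proj₂ (~⇒steps x<x′ x~x′))
                          in subst (y ~_) (func r″ r′) (steps⇒~ path)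
    ... | tri≈ _ refl _ = ~-reflexive (func r r′)
    ... | tri> _ _ x′<x = let _ , r″ , path = partialIso-steps r′ (proj₂ (~⇒steps x′<x (~-sym x~x′)))
                          in ~-sym (subst (y′ ~_) (func r″ r) (steps⇒~ path))

  partialIso-~ : ∀ {xs ys R} → PartialIso L xs ys R →
                 ∀ {x y x′ y′} → R x y → R x′ y′ → x ~ x′ ⇔ y ~ y′
  partialIso-~ π r r′ = mk⇔ (partialIso-~⁺ π r r′) (partialIso-~⁺ (partialIso-flip π) r r′)

module BlockTypes (em : ExcludedMiddle 0ℓ) (L : CountableLinearOrder) where
  open CountableLinearOrder L
  open Blocks L

  private
    dne : ∀ {P : Set} → ¬ ¬ P → P
    dne = em⇒dne em

  ¬∀⇒∃¬ : ∀ {P : ℕ → Set} → ¬ (∀ k → P k) → ∃ λ k → ¬ P k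
  ¬∀⇒∃¬ ¬∀P = dne λ ¬∃¬P → ¬∀P λ k → dne λ ¬Pk → ¬∃¬P (k , ¬Pk)

  InfiniteRight InfiniteLeft : Carrier → Set
  InfiniteRight x = ∀ k → ∃ λ y → Steps k x y
  InfiniteLeft x = ∀ k → ∃ λ y → Steps k y x

  leftEnd : ∀ k {x} → ¬ (∃ λ y → Steps k y x) → ∃₂ λ b j → Steps j b x × ¬ HasPred b
  leftEnd zero ¬steps = ⊥-elim (¬steps (_ , []))
  leftEnd (suc k) ¬steps with em {∃ λ y → Steps k y _}
  ... | yes (y , r) = y , k , r , λ (z , z⋖y) → ¬steps (z , z⋖y ∷ r)
  ... | no ¬steps′ = leftEnd k ¬steps′

  rightEnd : ∀ k {x} → ¬ (∃ λ y → Steps k x y) → ∃₂ λ e j → Steps j x e × ¬ HasSucc e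
  rightEnd zero ¬steps = ⊥-elim (¬steps (_ , []))
  rightEnd (suc k) ¬steps with em {∃ λ y → Steps k _ y}
  ... | yes (y , r) = y , k , r , λ (z , y⋖z) → ¬steps (z , steps-∷ʳ r y⋖z)
  ... | no ¬steps′ = rightEnd k ¬steps′

  zeta-type : ∀ {x} → InfiniteRight x → InfiniteLeft x → HasType L x zeta
  zeta-type {x} right left = f , x~f , f-onto , strictMono⇒reflects ℤ.<-cmp f f-mono
    where
    f : ℤ → Carrier
    f (+ k) = proj₁ (right k)
    f -[1+ k ] = proj₁ (left (suc k))
    →f : ∀ k → Steps k x (f (+ k))
    →f k = proj₂ (right k)
    f← : ∀ k → Steps (suc k) (f -[1+ k ]) x
    f← k = proj₂ (left (suc k))
    x~f : ∀ t → x ~ f t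
    x~f (+ k) = steps⇒~ (→f k)
    x~f -[1+ k ] = ~-sym (steps⇒~ (f← k))
    f-onto : ∀ y → x ~ y → ∃ λ t → f t ≡ y
    f-onto y x~y with compare x y
    ... | tri< x<y _ _ = let k , r = ~⇒steps x<y x~y in + suc k , steps-functionalʳ (→f (suc k)) r
    ... | tri≈ _ refl _ = + 0 , steps-functionalʳ (→f 0) []
    ... | tri> _ _ y<x = let k , r = ~⇒steps y<x (~-sym x~y) in -[1+ k ] , steps-functionalˡ (f← k) r
    f-mono : ∀ {s t} → s ℤ.< t → f s < f t
    f-mono (ℤ.-<+ {m} {n}) = steps-suc⇒< (steps-++ (f← m) (→f n))
    f-mono (ℤ.-<- n<m) = steps-monoˡ (f← _) (f← _) (s≤s n<m)
    f-mono (ℤ.+<+ m<n) = steps-monoʳ (→f _) (→f _) m<n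

  omega-type : ∀ {b} → ¬ HasPred b → InfiniteRight b → HasType L b omega
  omega-type {b} ¬pred right = f , x~f , f-onto , strictMono⇒reflects ℕ.<-cmp f f-mono
    where
    f : ℕ → Carrier
    f k = proj₁ (right k)
    →f : ∀ k → Steps k b (f k)
    →f k = proj₂ (right k)
    x~f : ∀ t → b ~ f t
    x~f k = steps⇒~ (→f k)
    f-onto : ∀ y → b ~ y → ∃ λ t → f t ≡ y
    f-onto y b~y with compare b y
    ... | tri< b<y _ _ = let k , r = ~⇒steps b<y b~y in suc k , steps-functionalʳ (→f (suc k)) r
    ... | tri≈ _ refl _ = 0 , steps-functionalʳ (→f 0) []
    ... | tri> _ _ y<b = ⊥-elim (¬HasPred⇒blockMin ¬pred y<b (~-sym b~y))
    f-mono : ∀ {s t} → s ℕ.< t → f s < f t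
    f-mono = steps-monoʳ (→f _) (→f _)

  omegaStar-type : ∀ {e} → ¬ HasSucc e → InfiniteLeft e → HasType L e omegaStar
  omegaStar-type {e} ¬succ left =
    f , x~f , f-onto , strictMono⇒reflects (Flip.compare ℕ._<_ ℕ.<-cmp) f f-mono
    where
    f : ℕ → Carrier
    f k = proj₁ (left k)
    f← : ∀ k → Steps k (f k) e
    f← k = proj₂ (left k)
    x~f : ∀ t → e ~ f t
    x~f k = ~-sym (steps⇒~ (f← k))
    f-onto : ∀ y → e ~ y → ∃ λ t → f t ≡ y
    f-onto y e~y with compare e y
    ... | tri< e<y _ _ = ⊥-elim (¬HasSucc⇒blockMax ¬succ e<y e~y)
    ... | tri≈ _ refl _ = 0 , steps-functionalˡ (f← 0) []
    ... | tri> _ _ y<e = let k , r = ~⇒steps y<e (~-sym e~y) in suc k , steps-functionalˡ (f← (suc k)) r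
    f-mono : ∀ {s t} → t ℕ.< s → f s < f t
    f-mono = steps-monoˡ (f← _) (f← _)

  finite-type : ∀ {b e N} → ¬ HasPred b → ¬ HasSucc e → Steps N b e → HasType L b (finite (suc N))
  finite-type {b} {e} {N} ¬pred ¬succ b→e = f , x~f , f-onto , strictMono⇒reflects Fin.<-cmp f f-mono
    where
    prefix : ∀ k → k ℕ.≤ N → ∃ λ y → Steps k b y
    prefix k k≤N =
      let y , b→y , _ = steps-split k (subst (λ m → Steps m b e) (sym (ℕ.m+[n∸m]≡n k≤N)) b→e)
      in y , b→y
    f : Fin (suc N) → Carrier
    f i = proj₁ (prefix (Fin.toℕ i) (ℕ.≤-pred (Fin.toℕ<n i)))
    →f : ∀ i → Steps (Fin.toℕ i) b (f i)
    →f i = proj₂ (prefix (Fin.toℕ i) (ℕ.≤-pred (Fin.toℕ<n i)))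
    x~f : ∀ t → b ~ f t
    x~f i = steps⇒~ (→f i)
    f-onto : ∀ y → b ~ y → ∃ λ t → f t ≡ y
    f-onto y b~y with compare b y
    ... | tri≈ _ refl _ = Fin.zero , steps-functionalʳ (→f Fin.zero) []
    ... | tri> _ _ y<b = ⊥-elim (¬HasPred⇒blockMin ¬pred y<b (~-sym b~y))
    ... | tri< b<y _ _ with ~⇒steps b<y b~y
    ... | k , b→y with suc k ℕ.≤? N
    ...   | yes k<N = let i = Fin.fromℕ< (s≤s k<N)
                          b→fi = subst (λ m → Steps m b (f i)) (Fin.toℕ-fromℕ< (s≤s k<N)) (→f i)
                      in i , steps-functionalʳ b→fi b→y
    ...   | no k≮N = ⊥-elim (¬HasSucc⇒blockMax ¬succ (steps-monoʳ b→e b→y (ℕ.≰⇒> k≮N))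
                                                  (~-trans (~-sym (steps⇒~ b→e)) b~y))
    f-mono : ∀ {s t} → s Fin.< t → f s < f t
    f-mono = steps-monoʳ (→f _) (→f _)

  infiniteRight-backwards : ∀ {j b x} → Steps j b x → InfiniteRight x → InfiniteRight b
  infiniteRight-backwards {j} {b} b→x right m =
    let y , x→y = right m
        z , b→z , _ = steps-split m (subst (λ n → Steps n b y) (ℕ.+-comm j m) (steps-++ b→x x→y))
    in z , b→z

  infiniteLeft-forwards : ∀ {j x e} → Steps j x e → InfiniteLeft x → InfiniteLeft e
  infiniteLeft-forwards {j} {x} {e} x→e left m =
    let y , y→x = left m
        z , _ , z→e = steps-split j (subst (λ n → Steps n y e) (ℕ.+-comm m j) (steps-++ y→x x→e))
    in z , z→e

  blockType : ∀ x → ∃ λ c → HasType L x c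
  blockType x with em {InfiniteRight x} | em {InfiniteLeft x}
  ... | yes right | yes left = zeta , zeta-type right left
  ... | yes right | no ¬left =
    let b , _ , b→x , ¬pred = leftEnd _ (proj₂ (¬∀⇒∃¬ ¬left))
    in omega , hasType-resp-~ {c = omega} (steps⇒~ b→x)
                 (omega-type ¬pred (infiniteRight-backwards b→x right))
  ... | no ¬right | yes left =
    let e , _ , x→e , ¬succ = rightEnd _ (proj₂ (¬∀⇒∃¬ ¬right))
    in omegaStar , hasType-resp-~ {c = omegaStar} (~-sym (steps⇒~ x→e))
                     (omegaStar-type ¬succ (infiniteLeft-forwards x→e left))
  ... | no ¬right | no ¬left =
    let b , j , b→x , ¬pred = leftEnd _ (proj₂ (¬∀⇒∃¬ ¬left))
        e , j′ , x→e , ¬succ = rightEnd _ (proj₂ (¬∀⇒∃¬ ¬right))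
        N = j + j′
    in finite (suc N) , hasType-resp-~ {c = finite (suc N)} (steps⇒~ b→x)
                          (finite-type ¬pred ¬succ (steps-++ b→x x→e))

module CanonicalBlockIsos (em : ExcludedMiddle 0ℓ) (L : CountableLinearOrder) where
  open CountableLinearOrder L
  open Blocks L
  open BlockTypes em L

  sameType⇒blockIso : ∀ {a b c} → HasType L a c → HasType L b c → ∃ λ h → BlockIso a b h
  sameType⇒blockIso {a} {b} {c} (fa , a~fa , fa-onto , fa-ord) (fb , b~fb , fb-onto , fb-ord) =
    h , record { maps = h-maps ; onto = h-onto ; ord = h-ord }
    where
    h : Carrier → Carrier
    h z with em {a ~ z}
    ... | yes a~z = fb (proj₁ (fa-onto z a~z))
    ... | no _ = z
    h-spec : ∀ z → a ~ z → ∃ λ t → fa t ≡ z × h z ≡ fb t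
    h-spec z a~z with em {a ~ z}
    ... | yes a~z′ = proj₁ (fa-onto z a~z′) , proj₂ (fa-onto z a~z′) , refl
    ... | no a≁z = ⊥-elim (a≁z a~z)
    h-maps : ∀ z → a ~ z → b ~ h z
    h-maps z a~z with h-spec z a~z
    ... | t , _ , hz≡fbt = subst (b ~_) (sym hz≡fbt) (b~fb t)
    h-onto : ∀ w → b ~ w → ∃ λ z → a ~ z × h z ≡ w
    h-onto w b~w with fb-onto w b~w
    ... | t , refl with h-spec (fa t) (a~fa t)
    ... | t′ , fat′≡fat , hz≡fbt′ =
      fa t , a~fa t , trans≡ hz≡fbt′ (same-order⇒same-kernel fa-ord fb-ord fat′≡fat)
    h-ord : ∀ z z′ → a ~ z → a ~ z′ → z < z′ ⇔ h z < h z′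
    h-ord z z′ a~z a~z′ with h-spec z a~z | h-spec z′ a~z′
    ... | t , refl , hz≡fbt | t′ , refl , hz′≡fbt′ rewrite hz≡fbt | hz′≡fbt′ =
      ⇔.trans (⇔.sym (fa-ord t t′)) (fb-ord t t′)

  least : (P : ℕ → Set) → ∀ {n} → P n → ∃ λ k → P k × (∀ j → P j → k ℕ.≤ j)
  least P {n} = search (suc n) ℕ.≤-refl
    where
    search : ∀ fuel {m} → m ℕ.< fuel → P m → ∃ λ k → P k × (∀ j → P j → k ℕ.≤ j)
    search (suc fuel) {m} (s≤s m≤fuel) pm with em {∃ λ j → j ℕ.< m × P j}
    ... | yes (j , j<m , pj) = search fuel (ℕ.≤-trans j<m m≤fuel) pj
    ... | no ¬smaller = m , pm , λ j pj → ℕ.≮⇒≥ λ j<m → ¬smaller (j , j<m , pj)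

  private
    BlockCode : Carrier → ℕ → Set
    BlockCode x k = ∃ λ z → x ~ z × code z ≡ k

    minCode : ∀ x → ∃ λ k → BlockCode x k × (∀ j → BlockCode x j → k ℕ.≤ j)
    minCode x = least (BlockCode x) (x , ~-refl , refl)

  -- The element of least code in the block of x; this is where the
  -- countability of L is used.
  rep : Carrier → Carrier
  rep x = proj₁ (proj₁ (proj₂ (minCode x)))

  rep-~ : ∀ x → x ~ rep x
  rep-~ x = proj₁ (proj₂ (proj₁ (proj₂ (minCode x))))

  rep-minimal : ∀ {x y} → x ~ y → code (rep x) ℕ.≤ code y
  rep-minimal {x} {y} x~y = let _ , (_ , _ , code≡k) , k-min = minCode x in
    subst (ℕ._≤ code y) (sym code≡k) (k-min (code y) (y , x~y , refl))

  rep-cong : ∀ {x y} → x ~ y → rep x ≡ rep y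
  rep-cong {x} {y} x~y = code-inj (ℕ.≤-antisym
    (rep-minimal (~-trans x~y (rep-~ y)))
    (rep-minimal (~-trans (~-sym x~y) (rep-~ x))))

  chooseBlockIso : Carrier → Carrier → Carrier → Carrier
  chooseBlockIso a b with em {∃ λ h → BlockIso a b h}
  ... | yes (h , _) = h
  ... | no _ = λ z → z

  chooseBlockIso-correct : ∀ {a b} → (∃ λ h → BlockIso a b h) → BlockIso a b (chooseBlockIso a b)
  chooseBlockIso-correct {a} {b} iso with em {∃ λ h → BlockIso a b h}
  ... | yes (_ , iso′) = iso′
  ... | no ¬iso = ⊥-elim (¬iso iso)

  canonicalIso : Carrier → Carrier → Carrier → Carrier
  canonicalIso x y = chooseBlockIso (rep x) (rep y)

  canonicalIso-cong : ∀ {x x′ y y′} → x ~ x′ → y ~ y′ → canonicalIso x y ≡ canonicalIso x′ y′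
  canonicalIso-cong x~x′ y~y′ = cong₂ chooseBlockIso (rep-cong x~x′) (rep-cong y~y′)

  canonicalIso-blockIso : ∀ {x y} → (∀ c → HasType L x c → HasType L y c) →
                          BlockIso x y (canonicalIso x y)
  canonicalIso-blockIso {x} {y} types⊆ =
    let c , x:c = blockType x
        rx:c = hasType-resp-~ (rep-~ x) x:c
        ry:c = hasType-resp-~ (rep-~ y) (types⊆ c x:c)
    in blockIso-resp-~ (~-sym (rep-~ x)) (~-sym (rep-~ y))
         (chooseBlockIso-correct (sameType⇒blockIso rx:c ry:c))

module Homogeneity (em : ExcludedMiddle 0ℓ) (L : CountableLinearOrder) where
  open CountableLinearOrder L
  open Blocks L
  open CanonicalBlockIsos em L

  private
    by-cases : ∀ {P A : Set} → (P → A) → (¬ P → A) → A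
    by-cases {P} yes-case no-case with em {P}
    ... | yes p = yes-case p
    ... | no ¬p = no-case ¬p

  partialIso-BkLt : ∀ {xs ys R} → PartialIso L xs ys R →
                    ∀ {x y x′ y′} → R x y → R x′ y′ → BkLt L x x′ ⇔ BkLt L y y′
  partialIso-BkLt π r r′ =
    mk⇔ (λ (x<x′ , x≁x′) → to (ord r r′) x<x′ , x≁x′ ∘ from (partialIso-~ π r r′))
        (λ (y<y′ , y≁y′) → from (ord r r′) y<y′ , y≁y′ ∘ to (partialIso-~ π r r′))
    where open PartialIso π

  module Extension {xs ys R} (π : PartialIso L xs ys R) where
    open PartialIso π

    extend : (Carrier → Carrier) → Carrier → Carrier
    extend k z with em {Gen L xs z}
    ... | yes g = proj₁ (total z g)
    ... | no _ = k z

    extend-gen : ∀ k {z} → Gen L xs z → R z (extend k z)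
    extend-gen k {z} g with em {Gen L xs z}
    ... | yes g′ = proj₂ (total z g′)
    ... | no ¬g = ⊥-elim (¬g g)

    extend-¬gen : ∀ k {z} → ¬ Gen L xs z → extend k z ≡ k z
    extend-¬gen k {z} ¬g with em {Gen L xs z}
    ... | yes g = ⊥-elim (¬g g)
    ... | no _ = refl

    partialIso-blockIso : ∀ {x y} → R x y → BlockIso x y (extend (λ z → z))
    partialIso-blockIso r = record
      { maps = λ z x~z → partialIso-~⁺ π r (extend-gen _ (gen-resp-~ (dom⊆ r) x~z)) x~z
      ; onto = λ w y~w → let z , rzw = onto w (gen-resp-~ (ran⊆ r) y~w)
                         in z , from (partialIso-~ π r rzw) y~w , func (extend-gen _ (dom⊆ rzw)) rzw
      ; ord  = λ z z′ x~z x~z′ → ord (extend-gen _ (gen-resp-~ (dom⊆ r) x~z))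
                                     (extend-gen _ (gen-resp-~ (dom⊆ r) x~z′))
      }

  partialIso-hasType : ∀ {xs ys R} → PartialIso L xs ys R →
                       ∀ {x y} → R x y → ∀ c → HasType L x c ⇔ HasType L y c
  partialIso-hasType π r c =
    mk⇔ (hasType-transport (Extension.partialIso-blockIso π r))
        (hasType-transport (Extension.partialIso-blockIso (partialIso-flip π) r))

  module BlockMapLifting
    (n : ℕ) (xs ys : Fin n → Carrier)
    (same-~ : ∀ i j → xs i ~ xs j ⇔ ys i ~ ys j)
    (same-BkLt : ∀ i j → BkLt L (xs i) (xs j) ⇔ BkLt L (ys i) (ys j))
    (same-type : ∀ i c → HasType L (xs i) c ⇔ HasType L (ys i) c)
    where

    H : Fin n → Carrier → Carrier
    H i = canonicalIso (xs i) (ys i)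

    H-iso : ∀ i → BlockIso (xs i) (ys i) (H i)
    H-iso i = canonicalIso-blockIso (λ c → to (same-type i c))

    H-cong : ∀ {i j} → xs i ~ xs j → H i ≡ H j
    H-cong xi~xj = canonicalIso-cong xi~xj (to (same-~ _ _) xi~xj)

    H-maps : ∀ {i x} → xs i ~ x → ys i ~ H i x
    H-maps {i} {x} = BlockIso.maps (H-iso i) x

    H-~ : ∀ {i j x x′} → xs i ~ x → xs j ~ x′ → x ~ x′ ⇔ H i x ~ H j x′
    H-~ {i} {j} xi~x xj~x′ = mk⇔
      (λ x~x′ → let yi~yj = to (same-~ i j) (~-trans xi~x (~-trans x~x′ (~-sym xj~x′)))
                in ~-trans (~-sym (H-maps xi~x)) (~-trans yi~yj (H-maps xj~x′)))
      (λ y~y′ → let yi~yj = ~-trans (H-maps xi~x) (~-trans y~y′ (~-sym (H-maps xj~x′)))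
                in ~-trans (~-sym xi~x) (~-trans (from (same-~ i j) yi~yj) xj~x′))

    R : Carrier → Carrier → Set
    R x y = ∃ λ i → xs i ~ x × H i x ≡ y

    R-ord : ∀ {x y x′ y′} → R x y → R x′ y′ → x < x′ ⇔ y < y′
    R-ord {x} {_} {x′} (i , xi~x , refl) (j , xj~x′ , refl) with em {x ~ x′}
    ... | yes x~x′ rewrite H-cong {j} {i} (~-trans xj~x′ (~-trans (~-sym x~x′) (~-sym xi~x))) =
      BlockIso.ord (H-iso i) x x′ xi~x (~-trans xi~x x~x′)
    ... | no x≁x′ = begin
      x < x′                   ∼⟨ ≁⇒<⇔BkLt x≁x′ ⟩
      BkLt L x x′              ∼⟨ BkLt-cong (~-sym xi~x) (~-sym xj~x′) ⟩
      BkLt L (xs i) (xs j)     ∼⟨ same-BkLt i j ⟩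
      BkLt L (ys i) (ys j)     ∼⟨ BkLt-cong (H-maps xi~x) (H-maps xj~x′) ⟩
      BkLt L (H i x) (H j x′)  ∼⟨ ⇔.sym (≁⇒<⇔BkLt (x≁x′ ∘ from (H-~ xi~x xj~x′))) ⟩
      H i x < H j x′           ∎
      where open EquationalReasoning

    R-⋖ : ∀ {x y x′ y′} → R x y → R x′ y′ → x ⋖ x′ ⇔ y ⋖ y′
    R-⋖ {x} {_} {x′} (i , xi~x , refl) (j , xj~x′ , refl) = mk⇔
      (λ x⋖x′ → let x~x′ = ⋖⇒~ x⋖x′
                in subst (H i x ⋖_) (Hi≡Hj x~x′) (to (within-block x~x′) x⋖x′))
      (λ y⋖y′ → let x~x′ = from (H-~ xi~x xj~x′) (⋖⇒~ y⋖y′)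
                in from (within-block x~x′) (subst (H i x ⋖_) (sym (Hi≡Hj x~x′)) y⋖y′))
      where
      Hi≡Hj : x ~ x′ → H i x′ ≡ H j x′
      Hi≡Hj x~x′ = cong (λ h → h x′) (H-cong (~-trans xi~x (~-trans x~x′ (~-sym xj~x′))))
      within-block : x ~ x′ → x ⋖ x′ ⇔ H i x ⋖ H i x′
      within-block x~x′ = blockIso-⋖ (H-iso i) xi~x (~-trans xi~x x~x′)

    generatedBy : ∀ {zs : Fin n → Carrier} {x} → Gen L (tabulate zs) x → ∃ λ i → zs i ~ x
    generatedBy g with gen⇒~generator g
    ... | _ , z∈zs , z~x with ∈-tabulate⁻ z∈zs
    ... | i , refl = i , z~x

    generates : ∀ {zs : Fin n → Carrier} {x} i → zs i ~ x → Gen L (tabulate zs) x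
    generates i = gen-resp-~ (base (∈-tabulate⁺ i))

    R-partialIso : PartialIso L (tabulate xs) (tabulate ys) R
    R-partialIso = record
      { total = λ x g → let i , xi~x = generatedBy g in H i x , i , xi~x , refl
      ; dom⊆  = λ (i , xi~x , _) → generates i xi~x
      ; onto  = λ y g → let i , yi~y = generatedBy g
                            x , xi~x , Hix≡y = BlockIso.onto (H-iso i) y yi~y
                        in x , i , xi~x , Hix≡y
      ; ran⊆  = λ { (i , xi~x , refl) → generates i (BlockIso.maps (H-iso i) _ xi~x) }
      ; func  = λ { {x} (i , xi~x , refl) (j , xj~x , refl) →
                    cong (λ h → h x) (H-cong (~-trans xi~x (~-sym xj~x))) }
      ; inj   = R-injective
      ; ord   = R-ord
      ; succ  = R-⋖
      }
      where
      R-injective : ∀ {x x′ y} → R x y → R x′ y → x ≡ x′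
      R-injective {x} {x′} (i , xi~x , Hix≡y) (j , xj~x′ , Hjx′≡y) =
        let x~x′ = from (H-~ xi~x xj~x′) (~-reflexive (trans≡ Hix≡y (sym Hjx′≡y)))
            Hj≡Hi = H-cong (~-trans xj~x′ (~-trans (~-sym x~x′) (~-sym xi~x)))
        in blockIso-injective (H-iso i) xi~x (~-trans xi~x x~x′)
             (trans≡ Hix≡y (trans≡ (sym Hjx′≡y) (cong (λ h → h x′) Hj≡Hi)))

    extendToBlockAutomorphism : HomogeneousL L →
      Σ (Carrier → Carrier) λ g → BlockAutomorphism L g × (∀ i → g (xs i) ~ ys i)
    extendToBlockAutomorphism homL with homL (tabulate xs) (tabulate ys) R R-partialIso
    ... | G , G-aut , extends = G , G-blockAutomorphism , λ i →
      ~-trans (~-reflexive (extends (i , ~-refl , refl))) (~-sym (BlockIso.maps (H-iso i) (xs i) ~-refl))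
      where open OrderIsoProperties (automorphism⇒orderIso G-aut)

  homogeneousL⇒Φ : HomogeneousL L → HomogeneousΦ L
  homogeneousL⇒Φ homL n xs ys same-~ same-BkLt same-type =
    BlockMapLifting.extendToBlockAutomorphism n xs ys same-~ same-BkLt same-type homL

  module PartialIsoExtension (homΦ : HomogeneousΦ L) {xs ys R} (π : PartialIso L xs ys R) where
    open PartialIso π
    open Extension π

    xs′ ys′ : Fin (length xs) → Carrier
    xs′ = lookup xs
    ys′ i = proj₁ (total (xs′ i) (base (∈-lookup i)))

    R-xs′-ys′ : ∀ i → R (xs′ i) (ys′ i)
    R-xs′-ys′ i = proj₂ (total (xs′ i) (base (∈-lookup i)))

    blockLift : Σ (Carrier → Carrier) λ g → BlockAutomorphism L g × (∀ i → g (xs′ i) ~ ys′ i)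
    blockLift = homΦ (length xs) xs′ ys′
      (λ i j → partialIso-~ π (R-xs′-ys′ i) (R-xs′-ys′ j))
      (λ i j → partialIso-BkLt π (R-xs′-ys′ i) (R-xs′-ys′ j))
      (λ i → partialIso-hasType π (R-xs′-ys′ i))

    g : Carrier → Carrier
    g = proj₁ blockLift

    open BlockAutomorphism (proj₁ (proj₂ blockLift)) renaming (onto to g-onto; ord to g-BkLt)

    K : Carrier → Carrier → Carrier
    K z = canonicalIso z (g z)

    K-iso : ∀ z → BlockIso z (g z) (K z)
    K-iso z = canonicalIso-blockIso λ c → to (color z c)

    K-cong : ∀ {z z′} → z ~ z′ → K z ≡ K z′
    K-cong {z} {z′} z~z′ = canonicalIso-cong z~z′ (resp z z′ z~z′)

    G : Carrier → Carrier
    G = extend (λ z → K z z)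

    G~g : ∀ z → G z ~ g z
    G~g z = by-cases inside outside
      where
      outside : ¬ Gen L xs z → G z ~ g z
      outside ¬gen = subst (_~ g z) (sym (extend-¬gen _ ¬gen)) (~-sym (BlockIso.maps (K-iso z) z ~-refl))
      inside : Gen L xs z → G z ~ g z
      inside gen with gen⇒~generator gen
      ... | w , w∈xs , w~z =
        let i = Any.index w∈xs
            xi~z = subst (_~ z) (lookup-index w∈xs) w~z
        in ~-trans (partialIso-~⁺ π (extend-gen _ gen) (R-xs′-ys′ i) (~-sym xi~z))
             (~-trans (~-sym (proj₂ (proj₂ blockLift) i)) (resp (xs′ i) z xi~z))

    G-mono : ∀ {x y} → x < y → G x < G y
    G-mono {x} {y} x<y = by-cases same-block different-blocks
      where
      different-blocks : ¬ x ~ y → G x < G y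
      different-blocks x≁y =
        proj₁ (BkLt-resp-~ (~-sym (G~g x)) (~-sym (G~g y)) (to (g-BkLt x y) (x<y , x≁y)))
      same-block : x ~ y → G x < G y
      same-block x~y = by-cases inside outside
        where
        inside : Gen L xs x → G x < G y
        inside gen = to (ord (extend-gen _ gen) (extend-gen _ (gen-resp-~ gen x~y))) x<y
        outside : ¬ Gen L xs x → G x < G y
        outside ¬gen-x =
          let ¬gen-y = ¬gen-x ∘ flip gen-resp-~ (~-sym x~y)
              Gy≡Kxy = trans≡ (extend-¬gen _ ¬gen-y) (cong (λ h → h y) (sym (K-cong x~y)))
          in subst₂ _<_ (sym (extend-¬gen _ ¬gen-x)) (sym Gy≡Kxy)
                        (to (BlockIso.ord (K-iso x) x y ~-refl x~y) x<y)

    G-onto : ∀ w → ∃ λ z → G z ≡ w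
    G-onto w = by-cases inside outside
      where
      inside : Gen L ys w → ∃ λ z → G z ≡ w
      inside gen = let z , rzw = onto w gen in z , func (extend-gen _ (dom⊆ rzw)) rzw
      outside : ¬ Gen L ys w → ∃ λ z → G z ≡ w
      outside ¬gen =
        let x , gx~w = g-onto w
            ¬gen-x : ¬ Gen L xs x
            ¬gen-x gen-x = ¬gen (gen-resp-~ (ran⊆ (extend-gen _ gen-x)) (~-trans (G~g x) gx~w))
            z , x~z , Kxz≡w = BlockIso.onto (K-iso x) w gx~w
        in z , trans≡ (extend-¬gen _ (¬gen-x ∘ flip gen-resp-~ (~-sym x~z)))
                      (trans≡ (cong (λ h → h z) (sym (K-cong x~z))) Kxz≡w)

    G-orderIso : OrderIso G
    G-orderIso = strictMono⇒reflects compare G G-mono , G-onto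

    extendToAutomorphism :
      Σ (Carrier → Carrier) λ G → Automorphism L G × (∀ {x y} → R x y → G x ≡ y)
    extendToAutomorphism = G , OrderIsoProperties.G-automorphism G-orderIso ,
                           λ r → func (extend-gen _ (dom⊆ r)) r

  homogeneousΦ⇒L : HomogeneousΦ L → HomogeneousL L
  homogeneousΦ⇒L homΦ xs ys R π = PartialIsoExtension.extendToAutomorphism homΦ π

mainTheorem18 : ExcludedMiddle 0ℓ → ExcludedMiddle (Level.suc 0ℓ) →
    (L : CountableLinearOrder) → HomogeneousL L ⇔ HomogeneousΦ L
mainTheorem18 em _ L = mk⇔ homogeneousL⇒Φ homogeneousΦ⇒L
  where open Homogeneity em L
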